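{- For every odd prime $p$, $\gamma^{\mathrm{LID}}(K_p^3) = p^2$; equivalently, the smallest dimension of a linear identifying code in $\mathbb{F}_p^3$ is $2$.
   Context: $K_p^3$ is the Hamming graph with vertex set $\mathbb{F}_p^3$, two vertices adjacent iff they differ in exactly one coordinate. For $C \subseteq \mathbb{F}_p^3$, $J_C(v) = N[v] \cap C$ with $N[v]$ the closed neighborhood. $C$ is an identifying code if the sets $J_C(v)$ are all nonempty and pairwise distinct; a linear identifying code is an identifying code that is an $\mathbb{F}_p$-linear subspace. $\gamma^{\mathrm{LID}}$ is the minimum cardinality of a linear identifying code. -}

module Defs where

open import Data.Nat using (ℕ; zero; suc; _+_; _*_; _≤_; NonZero)
open import Data.Nat.DivMod using (_mod_)
open import Data.Fin using (Fin; toℕ)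
open import Data.Fin.Properties using (_≟_)
open import Data.Bool using (Bool; true; false)
import Data.Bool as B
open import Data.List using (List; allFin; concatMap; map; filter; length)
open import Data.Product using (_×_; _,_; ∃)
open import Data.Sum using (_⊎_)
open import Relation.Nullary using (¬_)
open import Relation.Binary.PropositionalEquality using (_≡_; _≢_)
open import Relation.Nullary.Decidable using (does)

-- The prime field F_p, modelled as Fin p with arithmetic modulo p.
module _ (p : ℕ) .{{_ : NonZero p}} where

  V3 : Set
  V3 = Fin p × Fin p × Fin p

  addF : Fin p → Fin p → Fin p
  addF a b = (toℕ a + toℕ b) mod p

  mulF : Fin p → Fin p → Fin p
  mulF a b = (toℕ a * toℕ b) mod p

  zeroF : Fin p
  zeroF = 0 mod p

  zeroV : V3
  zeroV = zeroF , zeroF , zeroF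

  addV : V3 → V3 → V3
  addV (a₁ , a₂ , a₃) (b₁ , b₂ , b₃) = addF a₁ b₁ , addF a₂ b₂ , addF a₃ b₃

  scaleV : Fin p → V3 → V3
  scaleV c (a₁ , a₂ , a₃) = mulF c a₁ , mulF c a₂ , mulF c a₃

  diff : Fin p → Fin p → ℕ
  diff a b with does (a ≟ b)
  ... | true  = 0
  ... | false = 1

  hamming : V3 → V3 → ℕ
  hamming (a₁ , a₂ , a₃) (b₁ , b₂ , b₃) = diff a₁ b₁ + diff a₂ b₂ + diff a₃ b₃

  Adjacent : V3 → V3 → Set
  Adjacent u v = hamming u v ≡ 1

  InClosedNbhd : V3 → V3 → Set
  InClosedNbhd v w = w ≡ v ⊎ Adjacent v w

  allV : List V3
  allV = concatMap (λ a → concatMap (λ b → map (λ c → a , b , c) (allFin p)) (allFin p)) (allFin p)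

  Code : Set
  Code = V3 → Bool

  _∈C_ : V3 → Code → Set
  v ∈C C = C v ≡ true

  card : Code → ℕ
  card C = length (filter (λ v → C v B.≟ true) allV)

  _∈J[_,_] : V3 → Code → V3 → Set
  w ∈J[ C , v ] = InClosedNbhd v w × (w ∈C C)

  IsIdentifyingCode : Code → Set
  IsIdentifyingCode C =
    (∀ v → ∃ λ w → w ∈J[ C , v ]) ×
    (∀ u v → u ≢ v → ¬ (∀ w → (w ∈J[ C , u ] → w ∈J[ C , v ]) × (w ∈J[ C , v ] → w ∈J[ C , u ])))

  IsLinear : Code → Set
  IsLinear C =
    (zeroV ∈C C) ×
    (∀ u v → u ∈C C → v ∈C C → addV u v ∈C C) ×
    (∀ c v → v ∈C C → scaleV c v ∈C C)

  IsLinearIdentifyingCode : Code → Set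
  IsLinearIdentifyingCode C = IsLinear C × IsIdentifyingCode C

  γLID≡ : ℕ → Set
  γLID≡ m =
    (∃ λ C → IsLinearIdentifyingCode C × card C ≡ m) ×
    (∀ C → IsLinearIdentifyingCode C → m ≤ card C)

-- Upper bound: the plane x₁ + x₂ + x₃ = 0 has p² points and is an identifying code.  Each axis
-- line meets it exactly once, so a vertex off the plane sees three codewords, one on each axis
-- line through it, and no other vertex is within distance one of all three; a vertex on the
-- plane sees only itself.
--
-- Lower bound: for a linear code C and an axis i, the vertices whose i-th axis line meets C form
-- a subspace (the preimage of the projection of C forgetting coordinate i).  If C is dominating,
-- these three subspaces cover F_p³.  As 2 is invertible modulo p, a vector space over F_p is not
-- the union of three proper subspaces, so some projection of C is onto F_p² and |C| ≥ p².
module Submission where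

open import Defs
open import Level using (0ℓ)
open import Data.Nat as ℕ using (ℕ; zero; suc; NonZero; _^_; _%_; _∸_; _≤_)
import Data.Nat.Properties as ℕ
open import Data.Nat.DivMod
  using (_mod_; _/_; m%n<n; m<n⇒m%n≡m; m≡m%n+[m/n]*n; [m+n]%n≡m%n; %-distribˡ-+; %-distribˡ-*)
open import Data.Nat.Primality using (Prime)
open import Data.Nat.Tactic.RingSolver using (solve-∀)
open import Data.Fin as Fin using (Fin; toℕ)
open import Data.Fin.Properties
  using (toℕ-injective; toℕ-fromℕ<; toℕ<n; toℕ≤n; _≟_; all?; any?; ¬∀⟶∃¬)
open import Data.Bool using (Bool; true; false)
import Data.Bool as B
open import Data.List using (List; allFin; concatMap; map; filter; length; tabulate)
open import Data.List.Properties using (length-++; filter-++; map-tabulate)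
open import Data.Product using (∃; _×_; _,_; proj₁; proj₂)
open import Data.Sum using (_⊎_; inj₁; inj₂)
open import Function using (id; _∘_; _⇔_; mk⇔; Equivalence)
open import Algebra.Bundles using (CommutativeRing)
open import Algebra.Consequences.Propositional
  using (comm∧idˡ⇒id; comm∧invˡ⇒inv; comm∧distrʳ⇒distrˡ)
import Algebra.Properties.Ring as RingProperties
import Algebra.Properties.CommutativeSemigroup as CommutativeSemigroupProperties
open import Algebra.Properties.CommutativeMonoid.Sum ℕ.+-0-commutativeMonoid
  using (sum; sum-syntax; ∑-comm; sum-cong-≗; sum-replicate-zero)
open import Relation.Nullary using (¬_; Dec; yes; no; does; contradiction)
open import Relation.Nullary.Decidable using (dec-true)
open import Relation.Unary using (Pred; Decidable)
open import Relation.Binary.PropositionalEquality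
  using (_≡_; _≢_; refl; sym; trans; cong; cong₂; subst; isEquivalence; module ≡-Reasoning)

module ℤMod (n : ℕ) .{{_ : NonZero n}} where

  infixl 6 _+_
  infixl 7 _*_
  infix 8 -_

  _+_ _*_ : Fin n → Fin n → Fin n
  _+_ = addF n
  _*_ = mulF n

  [_] : ℕ → Fin n
  [ m ] = m mod n

  0# 1# : Fin n
  0# = [ 0 ]
  1# = [ 1 ]

  -_ : Fin n → Fin n
  - a = [ n ∸ toℕ a ]

  toℕ-[] : ∀ m → toℕ [ m ] ≡ m % n
  toℕ-[] m = toℕ-fromℕ< (m%n<n m n)

  []-cong : ∀ {m k} → m % n ≡ k % n → [ m ] ≡ [ k ]
  []-cong {m} {k} e = toℕ-injective (trans (toℕ-[] m) (trans e (sym (toℕ-[] k))))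

  []-toℕ : ∀ a → [ toℕ a ] ≡ a
  []-toℕ a = toℕ-injective (trans (toℕ-[] (toℕ a)) (m<n⇒m%n≡m (toℕ<n a)))

  []-+ : ∀ m k → [ m ℕ.+ k ] ≡ [ m ] + [ k ]
  []-+ m k = []-cong (trans (%-distribˡ-+ m k n)
    (sym (cong₂ (λ x y → (x ℕ.+ y) % n) (toℕ-[] m) (toℕ-[] k))))

  []-* : ∀ m k → [ m ℕ.* k ] ≡ [ m ] * [ k ]
  []-* m k = []-cong (trans (%-distribˡ-* m k n)
    (sym (cong₂ (λ x y → (x ℕ.* y) % n) (toℕ-[] m) (toℕ-[] k))))

  open ≡-Reasoning

  []-absorb-+ˡ : ∀ m k → [ toℕ [ m ] ℕ.+ k ] ≡ [ m ℕ.+ k ]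
  []-absorb-+ˡ m k = begin
    [ toℕ [ m ] ℕ.+ k ]   ≡⟨ []-+ _ k ⟩
    [ toℕ [ m ] ] + [ k ] ≡⟨ cong (_+ [ k ]) ([]-toℕ [ m ]) ⟩
    [ m ] + [ k ]         ≡⟨ []-+ m k ⟨
    [ m ℕ.+ k ]           ∎

  []-absorb-+ʳ : ∀ m k → [ m ℕ.+ toℕ [ k ] ] ≡ [ m ℕ.+ k ]
  []-absorb-+ʳ m k = begin
    [ m ℕ.+ toℕ [ k ] ] ≡⟨ cong [_] (ℕ.+-comm m _) ⟩
    [ toℕ [ k ] ℕ.+ m ] ≡⟨ []-absorb-+ˡ k m ⟩
    [ k ℕ.+ m ]         ≡⟨ cong [_] (ℕ.+-comm k m) ⟩
    [ m ℕ.+ k ]         ∎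

  []-absorb-*ˡ : ∀ m k → [ toℕ [ m ] ℕ.* k ] ≡ [ m ℕ.* k ]
  []-absorb-*ˡ m k = begin
    [ toℕ [ m ] ℕ.* k ]   ≡⟨ []-* _ k ⟩
    [ toℕ [ m ] ] * [ k ] ≡⟨ cong (_* [ k ]) ([]-toℕ [ m ]) ⟩
    [ m ] * [ k ]         ≡⟨ []-* m k ⟨
    [ m ℕ.* k ]           ∎

  []-absorb-*ʳ : ∀ m k → [ m ℕ.* toℕ [ k ] ] ≡ [ m ℕ.* k ]
  []-absorb-*ʳ m k = begin
    [ m ℕ.* toℕ [ k ] ] ≡⟨ cong [_] (ℕ.*-comm m _) ⟩
    [ toℕ [ k ] ℕ.* m ] ≡⟨ []-absorb-*ˡ k m ⟩
    [ k ℕ.* m ]         ≡⟨ cong [_] (ℕ.*-comm k m) ⟩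
    [ m ℕ.* k ]         ∎

  +-comm : ∀ a b → a + b ≡ b + a
  +-comm a b = cong [_] (ℕ.+-comm (toℕ a) (toℕ b))

  *-comm : ∀ a b → a * b ≡ b * a
  *-comm a b = cong [_] (ℕ.*-comm (toℕ a) (toℕ b))

  +-assoc : ∀ a b c → (a + b) + c ≡ a + (b + c)
  +-assoc a b c = begin
    [ toℕ (a + b) ℕ.+ toℕ c ]        ≡⟨ []-absorb-+ˡ _ (toℕ c) ⟩
    [ (toℕ a ℕ.+ toℕ b) ℕ.+ toℕ c ]  ≡⟨ cong [_] (ℕ.+-assoc (toℕ a) (toℕ b) (toℕ c)) ⟩
    [ toℕ a ℕ.+ (toℕ b ℕ.+ toℕ c) ]  ≡⟨ []-absorb-+ʳ (toℕ a) _ ⟨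
    [ toℕ a ℕ.+ toℕ (b + c) ]        ∎

  *-assoc : ∀ a b c → (a * b) * c ≡ a * (b * c)
  *-assoc a b c = begin
    [ toℕ (a * b) ℕ.* toℕ c ]        ≡⟨ []-absorb-*ˡ _ (toℕ c) ⟩
    [ (toℕ a ℕ.* toℕ b) ℕ.* toℕ c ]  ≡⟨ cong [_] (ℕ.*-assoc (toℕ a) (toℕ b) (toℕ c)) ⟩
    [ toℕ a ℕ.* (toℕ b ℕ.* toℕ c) ]  ≡⟨ []-absorb-*ʳ (toℕ a) _ ⟨
    [ toℕ a ℕ.* toℕ (b * c) ]        ∎

  +-identityˡ : ∀ a → 0# + a ≡ a
  +-identityˡ a = trans ([]-absorb-+ˡ 0 (toℕ a)) ([]-toℕ a)

  *-identityˡ : ∀ a → 1# * a ≡ a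
  *-identityˡ a = begin
    [ toℕ 1# ℕ.* toℕ a ] ≡⟨ []-absorb-*ˡ 1 (toℕ a) ⟩
    [ 1 ℕ.* toℕ a ]      ≡⟨ cong [_] (ℕ.*-identityˡ (toℕ a)) ⟩
    [ toℕ a ]            ≡⟨ []-toℕ a ⟩
    a                    ∎

  -‿inverseˡ : ∀ a → - a + a ≡ 0#
  -‿inverseˡ a = begin
    [ toℕ (- a) ℕ.+ toℕ a ]   ≡⟨ []-absorb-+ˡ _ (toℕ a) ⟩
    [ (n ∸ toℕ a) ℕ.+ toℕ a ] ≡⟨ cong [_] (ℕ.m∸n+n≡m (toℕ≤n a)) ⟩
    [ n ]                     ≡⟨ []-cong ([m+n]%n≡m%n 0 n) ⟩
    0#                        ∎

  *-distribʳ-+ : ∀ a b c → (b + c) * a ≡ b * a + c * a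
  *-distribʳ-+ a b c = begin
    [ toℕ (b + c) ℕ.* toℕ a ]               ≡⟨ []-absorb-*ˡ _ (toℕ a) ⟩
    [ (toℕ b ℕ.+ toℕ c) ℕ.* toℕ a ]         ≡⟨ cong [_] (ℕ.*-distribʳ-+ (toℕ a) (toℕ b) (toℕ c)) ⟩
    [ toℕ b ℕ.* toℕ a ℕ.+ toℕ c ℕ.* toℕ a ] ≡⟨ []-+ _ _ ⟩
    b * a + c * a                           ∎

  commutativeRing : CommutativeRing 0ℓ 0ℓ
  commutativeRing = record
    { Carrier = Fin n ; _≈_ = _≡_ ; _+_ = _+_ ; _*_ = _*_ ; -_ = -_ ; 0# = 0# ; 1# = 1#
    ; isCommutativeRing = record
      { isRing = record
        { +-isAbelianGroup = record
          { isGroup = record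
            { isMonoid = record
              { isSemigroup = record
                { isMagma = record { isEquivalence = isEquivalence ; ∙-cong = cong₂ _+_ }
                ; assoc = +-assoc }
              ; identity = comm∧idˡ⇒id +-comm +-identityˡ }
            ; inverse = comm∧invˡ⇒inv +-comm -‿inverseˡ
            ; ⁻¹-cong = cong -_ }
          ; comm = +-comm }
        ; *-cong = cong₂ _*_
        ; *-assoc = *-assoc
        ; *-identity = comm∧idˡ⇒id *-comm *-identityˡ
        ; distrib = comm∧distrʳ⇒distrˡ *-comm *-distribʳ-+ , *-distribʳ-+ }
      ; *-comm = *-comm } }

  half : Fin n
  half = [ suc (n / 2) ]

  half+half : n % 2 ≡ 1 → half + half ≡ 1#
  half+half odd = begin
    [ toℕ half ℕ.+ toℕ half ] ≡⟨ []-absorb-+ˡ _ _ ⟩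
    [ suc k ℕ.+ toℕ half ]    ≡⟨ []-absorb-+ʳ _ _ ⟩
    [ suc k ℕ.+ suc k ]       ≡⟨ cong [_] (double-suc k) ⟩
    [ 1 ℕ.+ (1 ℕ.+ k ℕ.* 2) ] ≡⟨ cong (λ m → [ 1 ℕ.+ m ]) n≡1+2k ⟨
    [ 1 ℕ.+ n ]               ≡⟨ []-cong ([m+n]%n≡m%n 1 n) ⟩
    1#                        ∎
    where
    k = n / 2
    double-suc : ∀ k → suc k ℕ.+ suc k ≡ 1 ℕ.+ (1 ℕ.+ k ℕ.* 2)
    double-suc = solve-∀
    n≡1+2k : n ≡ 1 ℕ.+ k ℕ.* 2
    n≡1+2k = trans (m≡m%n+[m/n]*n n 2) (cong (ℕ._+ k ℕ.* 2) odd)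

boolToℕ : Bool → ℕ
boolToℕ true  = 1
boolToℕ false = 0

count : ∀ {A : Set} → (A → Bool) → List A → ℕ
count f xs = length (filter (λ x → f x B.≟ true) xs)

count-tabulate : ∀ {A : Set} n (t : Fin n → A) (f : A → Bool) →
                 count f (tabulate t) ≡ ∑[ i < n ] boolToℕ (f (t i))
count-tabulate zero    t f = refl
count-tabulate (suc n) t f with f (t Fin.zero)
... | true  = cong suc (count-tabulate n (t ∘ Fin.suc) f)
... | false = count-tabulate n (t ∘ Fin.suc) f

count-concatMap-tabulate : ∀ {A B : Set} n (t : Fin n → A) (g : A → List B) (f : B → Bool) →
                           count f (concatMap g (tabulate t)) ≡ ∑[ i < n ] count f (g (t i))
count-concatMap-tabulate zero    t g f = refl
count-concatMap-tabulate (suc n) t g f = trans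
  (cong length (filter-++ (λ x → f x B.≟ true) (g (t Fin.zero)) _))
  (trans (length-++ (filter _ (g (t Fin.zero))))
         (cong (count f (g (t Fin.zero)) ℕ.+_) (count-concatMap-tabulate n (t ∘ Fin.suc) g f)))

∑-const : ∀ n k → ∑[ i < n ] k ≡ n ℕ.* k
∑-const zero    k = refl
∑-const (suc n) k = cong (k ℕ.+_) (∑-const n k)

∑-mono-≤ : ∀ {n} {f g : Fin n → ℕ} → (∀ i → f i ≤ g i) → sum f ≤ sum g
∑-mono-≤ {zero}  f≤g = ℕ.z≤n
∑-mono-≤ {suc n} f≤g = ℕ.+-mono-≤ (f≤g Fin.zero) (∑-mono-≤ (f≤g ∘ Fin.suc))

≤-∑ : ∀ {n} (f : Fin n → ℕ) i → f i ≤ sum f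
≤-∑ f Fin.zero    = ℕ.m≤m+n _ _
≤-∑ f (Fin.suc i) = ℕ.≤-trans (≤-∑ (f ∘ Fin.suc) i) (ℕ.m≤n+m _ _)

∑-indicator : ∀ {n} (t : Fin n) → ∑[ i < n ] boolToℕ (does (i ≟ t)) ≡ 1
∑-indicator {suc n} Fin.zero    = cong suc (sum-replicate-zero n)
∑-indicator {suc n} (Fin.suc t) = ∑-indicator t

∑∑1≡n² : ∀ n → ∑[ a < n ] ∑[ b < n ] 1 ≡ n ^ 2
∑∑1≡n² n = trans (∑-const n _) (cong (n ℕ.*_) (∑-const n 1))

n²≤∑∑∑ : ∀ n (f : Fin n → Fin n → Fin n → Bool) → (∀ a b → ∃ λ c → f a b c ≡ true) →
         n ^ 2 ≤ ∑[ a < n ] ∑[ b < n ] ∑[ c < n ] boolToℕ (f a b c)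
n²≤∑∑∑ n f fibre = begin
  n ^ 2                                          ≡⟨ ∑∑1≡n² n ⟨
  ∑[ a < n ] ∑[ b < n ] 1                        ≤⟨ ∑-mono-≤ (λ a → ∑-mono-≤ (nonempty a)) ⟩
  ∑[ a < n ] ∑[ b < n ] ∑[ c < n ] boolToℕ (f a b c) ∎
  where
  open ℕ.≤-Reasoning
  nonempty : ∀ a b → 1 ≤ ∑[ c < n ] boolToℕ (f a b c)
  nonempty a b = let c , fabc = fibre a b
                 in ℕ.≤-trans (ℕ.≤-reflexive (cong boolToℕ (sym fabc))) (≤-∑ _ c)

does-⇔ : ∀ {A B : Set} → A ⇔ B → (a? : Dec A) (b? : Dec B) → does a? ≡ does b?
does-⇔ A⇔B (yes _) (yes _) = refl
does-⇔ A⇔B (no _)  (no _)  = refl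
does-⇔ A⇔B (yes a) (no ¬b) = contradiction (Equivalence.to A⇔B a) ¬b
does-⇔ A⇔B (no ¬a) (yes b) = contradiction (Equivalence.from A⇔B b) ¬a

does≡true⇒ : ∀ {A : Set} (a? : Dec A) → does a? ≡ true → A
does≡true⇒ (yes a) _  = a
does≡true⇒ (no _)  ()

module Hamming (p : ℕ) .{{_ : NonZero p}} where

  open ℤMod p using (commutativeRing; half; half+half)
  open CommutativeRing commutativeRing
    using ( _+_; _*_; -_; 0#; 1#; +-comm; +-assoc; +-identityˡ; -‿inverseˡ
          ; distribˡ; distribʳ; *-identityˡ; zeroʳ; ring; +-commutativeSemigroup)
  open RingProperties ring using (-1*x≈-x; //-rightDividesʳ; +-inverseˡ-unique)
  open CommutativeSemigroupProperties +-commutativeSemigroup using (interchange; xy∙z≈y∙xz; xy∙z≈z∙xy)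
  open ≡-Reasoning

  F V : Set
  F = Fin p
  V = V3 p

  infixl 6 _⊕_
  infixr 7 _·_

  _⊕_ : V → V → V
  _⊕_ = addV p

  _·_ : F → V → V
  _·_ = scaleV p

  ≡-triple : ∀ {a b c a′ b′ c′ : F} → a ≡ a′ → b ≡ b′ → c ≡ c′ → (a , b , c) ≡ (a′ , b′ , c′)
  ≡-triple a≡a′ b≡b′ c≡c′ = cong₂ _,_ a≡a′ (cong₂ _,_ b≡b′ c≡c′)

  ⊕-assoc : ∀ u v w → (u ⊕ v) ⊕ w ≡ u ⊕ (v ⊕ w)
  ⊕-assoc (a , b , c) (a′ , b′ , c′) (a″ , b″ , c″) =
    ≡-triple (+-assoc a a′ a″) (+-assoc b b′ b″) (+-assoc c c′ c″)

  ⊕-comm : ∀ u v → u ⊕ v ≡ v ⊕ u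
  ⊕-comm (a , b , c) (a′ , b′ , c′) = ≡-triple (+-comm a a′) (+-comm b b′) (+-comm c c′)

  ⊕-cancel : ∀ u v → (u ⊕ v) ⊕ (- 1# · v) ≡ u
  ⊕-cancel (a , b , c) (a′ , b′ , c′) = ≡-triple (cancel a a′) (cancel b b′) (cancel c c′)
    where
    cancel : ∀ x y → (x + y) + - 1# * y ≡ x
    cancel x y = trans (cong ((x + y) +_) (-1*x≈-x y)) (//-rightDividesʳ y x)

  ·-halve : p % 2 ≡ 1 → ∀ v → half · (v ⊕ v) ≡ v
  ·-halve odd (a , b , c) = ≡-triple (halve a) (halve b) (halve c)
    where
    halve : ∀ x → half * (x + x) ≡ x
    halve x = begin
      half * (x + x)        ≡⟨ distribˡ half x x ⟩
      half * x + half * x   ≡⟨ distribʳ x half half ⟨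
      (half + half) * x     ≡⟨ cong (_* x) (half+half odd) ⟩
      1# * x                ≡⟨ *-identityˡ x ⟩
      x                     ∎

  Σ : V → F
  Σ (a , b , c) = a + b + c

  Σ-zeroV : Σ (zeroV p) ≡ 0#
  Σ-zeroV = trans (cong (_+ 0#) (+-identityˡ 0#)) (+-identityˡ 0#)

  Σ-⊕ : ∀ u v → Σ (u ⊕ v) ≡ Σ u + Σ v
  Σ-⊕ (a , b , c) (a′ , b′ , c′) = begin
    (a + a′) + (b + b′) + (c + c′) ≡⟨ cong (_+ (c + c′)) (interchange a a′ b b′) ⟩
    (a + b) + (a′ + b′) + (c + c′) ≡⟨ interchange (a + b) (a′ + b′) c c′ ⟩
    (a + b + c) + (a′ + b′ + c′)   ∎

  Σ-· : ∀ k v → Σ (k · v) ≡ k * Σ v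
  Σ-· k (a , b , c) = begin
    k * a + k * b + k * c  ≡⟨ cong (_+ k * c) (distribˡ k a b) ⟨
    k * (a + b) + k * c    ≡⟨ distribˡ k (a + b) c ⟨
    k * (a + b + c)        ∎

  ≡+⇒[≡0⇔≡-] : ∀ {s x y} → s ≡ x + y → s ≡ 0# ⇔ x ≡ - y
  ≡+⇒[≡0⇔≡-] {s} {x} {y} s≡x+y = mk⇔
    (λ s≡0 → +-inverseˡ-unique x y (trans (sym s≡x+y) s≡0))
    (λ x≡-y → trans s≡x+y (trans (cong (_+ y) x≡-y) (-‿inverseˡ y)))

  Σ≡0⇔₁ : ∀ a b c → Σ (a , b , c) ≡ 0# ⇔ a ≡ - (b + c)
  Σ≡0⇔₁ a b c = ≡+⇒[≡0⇔≡-] (+-assoc a b c)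

  Σ≡0⇔₂ : ∀ a b c → Σ (a , b , c) ≡ 0# ⇔ b ≡ - (a + c)
  Σ≡0⇔₂ a b c = ≡+⇒[≡0⇔≡-] (xy∙z≈y∙xz a b c)

  Σ≡0⇔₃ : ∀ a b c → Σ (a , b , c) ≡ 0# ⇔ c ≡ - (a + b)
  Σ≡0⇔₃ a b c = ≡+⇒[≡0⇔≡-] (xy∙z≈z∙xy a b c)

  data OnAxisLine : V → V → Set where
    along₁ : ∀ {a b c} x → OnAxisLine (a , b , c) (x , b , c)
    along₂ : ∀ {a b c} y → OnAxisLine (a , b , c) (a , y , c)
    along₃ : ∀ {a b c} z → OnAxisLine (a , b , c) (a , b , z)

  diff-refl : ∀ a → diff p a a ≡ 0
  diff-refl a with a ≟ a
  ... | yes _   = refl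
  ... | no a≢a = contradiction refl a≢a

  onAxisLine⇒closedNbhd : ∀ {v w} → OnAxisLine v w → InClosedNbhd p v w
  onAxisLine⇒closedNbhd (along₁ {a} {b} {c} x) with a ≟ x
  ... | yes refl = inj₁ refl
  ... | no _ rewrite diff-refl b | diff-refl c = inj₂ refl
  onAxisLine⇒closedNbhd (along₂ {a} {b} {c} y) with b ≟ y
  ... | yes refl = inj₁ refl
  ... | no _ rewrite diff-refl a | diff-refl c = inj₂ refl
  onAxisLine⇒closedNbhd (along₃ {a} {b} {c} z) with c ≟ z
  ... | yes refl = inj₁ refl
  ... | no _ rewrite diff-refl a | diff-refl b = inj₂ refl

  adjacent⇒onAxisLine : ∀ {v w} → Adjacent p v w → OnAxisLine v w
  adjacent⇒onAxisLine {a₁ , a₂ , a₃} {b₁ , b₂ , b₃} h with a₁ ≟ b₁ | a₂ ≟ b₂ | a₃ ≟ b₃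
  ... | yes refl | yes refl | _        = along₃ b₃
  ... | yes refl | no _     | yes refl = along₂ b₂
  ... | no _     | yes refl | yes refl = along₁ b₁
  ... | yes refl | no _     | no _     = contradiction h λ ()
  ... | no _     | yes refl | no _     = contradiction h λ ()
  ... | no _     | no _     | _        = contradiction h λ ()

  closedNbhd⇒onAxisLine : ∀ {v w} → InClosedNbhd p v w → OnAxisLine v w
  closedNbhd⇒onAxisLine {a , b , c} (inj₁ refl) = along₁ a
  closedNbhd⇒onAxisLine (inj₂ adj)             = adjacent⇒onAxisLine adj

  centre-of-three : ∀ {a b c x y z v} → x ≢ a → y ≢ b → z ≢ c →
                    OnAxisLine v (x , b , c) → OnAxisLine v (a , y , c) → OnAxisLine v (a , b , z) →
                    v ≡ (a , b , c)
  centre-of-three x≢a y≢b z≢c (along₁ _) (along₁ _) _          = contradiction refl y≢b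
  centre-of-three x≢a y≢b z≢c (along₁ _) (along₂ _) _          = refl
  centre-of-three x≢a y≢b z≢c (along₁ _) (along₃ _) _          = contradiction refl y≢b
  centre-of-three x≢a y≢b z≢c (along₂ _) _          (along₁ _) = contradiction refl z≢c
  centre-of-three x≢a y≢b z≢c (along₂ _) _          (along₂ _) = contradiction refl x≢a
  centre-of-three x≢a y≢b z≢c (along₂ _) _          (along₃ _) = contradiction refl x≢a
  centre-of-three x≢a y≢b z≢c (along₃ _) (along₁ _) _          = contradiction refl y≢b
  centre-of-three x≢a y≢b z≢c (along₃ _) (along₂ _) _          = contradiction refl x≢a
  centre-of-three x≢a y≢b z≢c (along₃ _) (along₃ _) _          = contradiction refl x≢a

  card≡∑∑∑ : ∀ C → card p C ≡ ∑[ a < p ] ∑[ b < p ] ∑[ c < p ] boolToℕ (C (a , b , c))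
  card≡∑∑∑ C = trans (count-concatMap-tabulate p id plane C)
    (sum-cong-≗ λ a → trans (count-concatMap-tabulate p id (line a) C)
      (sum-cong-≗ λ b → trans (cong (count C) (map-tabulate id (point a b)))
                              (count-tabulate p (point a b) C)))
    where
    point : F → F → F → V
    point a b c = a , b , c
    line : F → F → List V
    line a b = map (point a b) (allFin p)
    plane : F → List V
    plane a = concatMap (line a) (allFin p)

  zeroSumCode : Code p
  zeroSumCode v = does (Σ v ≟ 0#)

  zeroSumCode-linear : IsLinear p zeroSumCode
  zeroSumCode-linear =
      dec-true (Σ (zeroV p) ≟ 0#) Σ-zeroV
    , (λ u v u∈C v∈C → dec-true (Σ (u ⊕ v) ≟ 0#) (begin
        Σ (u ⊕ v)    ≡⟨ Σ-⊕ u v ⟩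
        Σ u + Σ v    ≡⟨ cong₂ _+_ (on-plane u u∈C) (on-plane v v∈C) ⟩
        0# + 0#      ≡⟨ +-identityˡ 0# ⟩
        0#           ∎))
    , (λ k v v∈C → dec-true (Σ (k · v) ≟ 0#) (begin
        Σ (k · v)    ≡⟨ Σ-· k v ⟩
        k * Σ v      ≡⟨ cong (k *_) (on-plane v v∈C) ⟩
        k * 0#       ≡⟨ zeroʳ k ⟩
        0#           ∎))
    where
    on-plane : ∀ v → zeroSumCode v ≡ true → Σ v ≡ 0#
    on-plane v = does≡true⇒ (Σ v ≟ 0#)

  card-zeroSumCode : card p zeroSumCode ≡ p ^ 2
  card-zeroSumCode = begin
    card p zeroSumCode                       ≡⟨ card≡∑∑∑ zeroSumCode ⟩
    ∑[ a < p ] ∑[ b < p ] ∑[ c < p ] χ a b c ≡⟨ sum-cong-≗ (λ a → sum-cong-≗ (fibre a)) ⟩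
    ∑[ a < p ] ∑[ b < p ] 1                  ≡⟨ ∑∑1≡n² p ⟩
    p ^ 2                                    ∎
    where
    χ : F → F → F → ℕ
    χ a b c = boolToℕ (does (Σ (a , b , c) ≟ 0#))
    fibre : ∀ a b → ∑[ c < p ] χ a b c ≡ 1
    fibre a b = trans
      (sum-cong-≗ λ c → cong boolToℕ (does-⇔ (Σ≡0⇔₃ a b c) (Σ (a , b , c) ≟ 0#) (c ≟ - (a + b))))
      (∑-indicator (- (a + b)))

  zeroSum-unique-on-line : ∀ {u w} → OnAxisLine u w → Σ u ≡ 0# → Σ w ≡ 0# → w ≡ u
  zeroSum-unique-on-line (along₁ {a} {b} {c} x) Σu≡0 Σw≡0 = cong (λ x → x , b , c)
    (trans (Equivalence.to (Σ≡0⇔₁ x b c) Σw≡0) (sym (Equivalence.to (Σ≡0⇔₁ a b c) Σu≡0)))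
  zeroSum-unique-on-line (along₂ {a} {b} {c} y) Σu≡0 Σw≡0 = cong (λ y → a , y , c)
    (trans (Equivalence.to (Σ≡0⇔₂ a y c) Σw≡0) (sym (Equivalence.to (Σ≡0⇔₂ a b c) Σu≡0)))
  zeroSum-unique-on-line (along₃ {a} {b} {c} z) Σu≡0 Σw≡0 = cong (λ z → a , b , z)
    (trans (Equivalence.to (Σ≡0⇔₃ a b z) Σw≡0) (sym (Equivalence.to (Σ≡0⇔₃ a b c) Σu≡0)))

  _∈J[_,_]ₚ : V → Code p → V → Set
  w ∈J[ C , v ]ₚ = _∈J[_,_] p w C v

  off-plane-determined : ∀ {u v} → Σ u ≢ 0# →
                         (∀ w → w ∈J[ zeroSumCode , u ]ₚ → w ∈J[ zeroSumCode , v ]ₚ) → v ≡ u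
  off-plane-determined {a , b , c} {v} Σu≢0 J⊆ = centre-of-three
    (λ x≡a → Σu≢0 (Equivalence.from (Σ≡0⇔₁ a b c) (sym x≡a)))
    (λ y≡b → Σu≢0 (Equivalence.from (Σ≡0⇔₂ a b c) (sym y≡b)))
    (λ z≡c → Σu≢0 (Equivalence.from (Σ≡0⇔₃ a b c) (sym z≡c)))
    (near-v (along₁ _) (Equivalence.from (Σ≡0⇔₁ _ b c) refl))
    (near-v (along₂ _) (Equivalence.from (Σ≡0⇔₂ a _ c) refl))
    (near-v (along₃ _) (Equivalence.from (Σ≡0⇔₃ a b _) refl))
    where
    near-v : ∀ {w} → OnAxisLine (a , b , c) w → Σ w ≡ 0# → OnAxisLine v w
    near-v {w} l Σw≡0 = closedNbhd⇒onAxisLine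
      (proj₁ (J⊆ w (onAxisLine⇒closedNbhd l , dec-true (Σ w ≟ 0#) Σw≡0)))

  zeroSumCode-identifying : IsIdentifyingCode p zeroSumCode
  zeroSumCode-identifying = dominating , separating
    where
    dominating : ∀ v → ∃ λ w → w ∈J[ zeroSumCode , v ]ₚ
    dominating (a , b , c) = (- (b + c) , b , c)
      , onAxisLine⇒closedNbhd (along₁ _)
      , dec-true (Σ (- (b + c) , b , c) ≟ 0#) (Equivalence.from (Σ≡0⇔₁ _ b c) refl)
    separating : ∀ u v → u ≢ v →
                 ¬ (∀ w → (w ∈J[ zeroSumCode , u ]ₚ → w ∈J[ zeroSumCode , v ]ₚ)
                        × (w ∈J[ zeroSumCode , v ]ₚ → w ∈J[ zeroSumCode , u ]ₚ))
    separating u v u≢v J≡ with Σ u ≟ 0# | Σ v ≟ 0#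
    ... | no Σu≢0 | _        = u≢v (sym (off-plane-determined Σu≢0 (proj₁ ∘ J≡)))
    ... | _        | no Σv≢0 = u≢v (off-plane-determined Σv≢0 (proj₂ ∘ J≡))
    ... | yes Σu≡0 | yes Σv≡0 = u≢v (zeroSum-unique-on-line (closedNbhd⇒onAxisLine v~u) Σv≡0 Σu≡0)
      where
      v~u : InClosedNbhd p v u
      v~u = proj₁ (proj₁ (J≡ u) (inj₁ refl , dec-true (Σ u ≟ 0#) Σu≡0))

  record IsLinearlyClosed (S : Pred V 0ℓ) : Set where
    field
      ⊕-closed : ∀ {u v} → S u → S v → S (u ⊕ v)
      ·-closed : ∀ k {v} → S v → S (k · v)

  module _ {S : Pred V 0ℓ} (closed : IsLinearlyClosed S) where
    open IsLinearlyClosed closed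

    ∈-cancelʳ : ∀ {u v} → S (u ⊕ v) → S v → S u
    ∈-cancelʳ {u} {v} u⊕v∈S v∈S = subst S (⊕-cancel u v) (⊕-closed u⊕v∈S (·-closed (- 1#) v∈S))

    ∈-cancelˡ : ∀ {u v} → S (u ⊕ v) → S u → S v
    ∈-cancelˡ {u} {v} u⊕v∈S = ∈-cancelʳ (subst S (⊕-comm u v) u⊕v∈S)

    ∈-halve : p % 2 ≡ 1 → ∀ {v} → S (v ⊕ v) → S v
    ∈-halve odd {v} v⊕v∈S = subst S (·-halve odd v) (·-closed half v⊕v∈S)

  AtMostOneOf : Pred V 0ℓ → V → V → V → Set
  AtMostOneOf S v₀ v₁ v₂ = (S v₀ → ¬ S v₁) × (S v₁ → ¬ S v₂) × (S v₀ → ¬ S v₂)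

  -- Two of the points w, w + z, w + 2z differ by z or by 2z, and 2 is invertible.
  line-meets-at-most-once : p % 2 ≡ 1 → ∀ {S z} → IsLinearlyClosed S → ¬ S z →
                            ∀ w → AtMostOneOf S w (w ⊕ z) (w ⊕ z ⊕ z)
  line-meets-at-most-once odd {S} {z} closed z∉S w =
      (λ w∈S w⊕z∈S → z∉S (∈-cancelˡ closed w⊕z∈S w∈S))
    , (λ w⊕z∈S w⊕z⊕z∈S → z∉S (∈-cancelˡ closed w⊕z⊕z∈S w⊕z∈S))
    , (λ w∈S w⊕z⊕z∈S → z∉S (∈-halve closed odd
         (∈-cancelˡ closed (subst S (⊕-assoc w z z) w⊕z⊕z∈S) w∈S)))

  pigeonhole : ∀ {S T U : Pred V 0ℓ} {v₀ v₁ v₂} → Decidable S → Decidable T →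
               AtMostOneOf S v₀ v₁ v₂ → AtMostOneOf T v₀ v₁ v₂ → ¬ U v₀ → ¬ U v₁ → ¬ U v₂ →
               ∃ λ v → ¬ S v × ¬ T v × ¬ U v
  pigeonhole {v₀ = v₀} {v₁} {v₂} S? T? (S₀₁ , S₁₂ , S₀₂) (T₀₁ , T₁₂ , T₀₂) ∉U₀ ∉U₁ ∉U₂
    with S? v₀ | T? v₀ | S? v₁ | T? v₁
  ... | no ∉S  | no ∉T  | _       | _       = v₀ , ∉S , ∉T , ∉U₀
  ... | yes ∈S | yes ∈T | _       | _       = v₁ , S₀₁ ∈S , T₀₁ ∈T , ∉U₁
  ... | yes ∈S | no _   | _       | no ∉T   = v₁ , S₀₁ ∈S , ∉T , ∉U₁
  ... | yes ∈S | no _   | _       | yes ∈T₁ = v₂ , S₀₂ ∈S , T₁₂ ∈T₁ , ∉U₂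
  ... | no _   | yes ∈T | no ∉S   | _       = v₁ , ∉S , T₀₁ ∈T , ∉U₁
  ... | no _   | yes ∈T | yes ∈S₁ | _       = v₂ , S₁₂ ∈S₁ , T₀₂ ∈T , ∉U₂

  avoid₂ : ∀ {S T x y} → IsLinearlyClosed S → IsLinearlyClosed T → Decidable S → Decidable T →
           ¬ S x → ¬ T y → ∃ λ z → ¬ S z × ¬ T z
  avoid₂ {x = x} {y} S-closed T-closed S? T? x∉S y∉T with T? x | S? y
  ... | no x∉T  | _       = x , x∉S , x∉T
  ... | _       | no y∉S  = y , y∉S , y∉T
  ... | yes x∈T | yes y∈S = x ⊕ y
    , (λ x⊕y∈S → x∉S (∈-cancelʳ S-closed x⊕y∈S y∈S))
    , (λ x⊕y∈T → y∉T (∈-cancelˡ T-closed x⊕y∈T x∈T))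

  avoid₃ : p % 2 ≡ 1 → ∀ {S₁ S₂ S₃ x₁ x₂ x₃} →
           IsLinearlyClosed S₁ → IsLinearlyClosed S₂ → IsLinearlyClosed S₃ →
           Decidable S₁ → Decidable S₂ → Decidable S₃ →
           ¬ S₁ x₁ → ¬ S₂ x₂ → ¬ S₃ x₃ → ∃ λ v → ¬ S₁ v × ¬ S₂ v × ¬ S₃ v
  avoid₃ odd {x₃ = w} closed₁ closed₂ closed₃ S₁? S₂? S₃? x₁∉ x₂∉ w∉
    with avoid₂ closed₁ closed₂ S₁? S₂? x₁∉ x₂∉
  ... | z , z∉₁ , z∉₂ with S₃? z
  ... | no z∉₃ = z , z∉₁ , z∉₂ , z∉₃
  ... | yes z∈₃ = pigeonhole S₁? S₂?
    (line-meets-at-most-once odd closed₁ z∉₁ w) (line-meets-at-most-once odd closed₂ z∉₂ w)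
    w∉ (λ w⊕z∈ → w∉ (∈-cancelʳ closed₃ w⊕z∈ z∈₃))
    (λ w⊕z⊕z∈ → w∉ (∈-cancelʳ closed₃ (∈-cancelʳ closed₃ w⊕z⊕z∈ z∈₃) z∈₃))

  data Axis : Set where
    ax₁ ax₂ ax₃ : Axis

  set : Axis → F → V → V
  set ax₁ x (_ , b , c) = x , b , c
  set ax₂ y (a , _ , c) = a , y , c
  set ax₃ z (a , b , _) = a , b , z

  Shadow : Code p → Axis → Pred V 0ℓ
  Shadow C i v = ∃ λ x → C (set i x v) ≡ true

  shadow? : ∀ C i → Decidable (Shadow C i)
  shadow? C i v = any? (λ x → C (set i x v) B.≟ true)

  set-⊕ : ∀ i {x y} u v → set i x u ⊕ set i y v ≡ set i (x + y) (u ⊕ v)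
  set-⊕ ax₁ (_ , _ , _) (_ , _ , _) = refl
  set-⊕ ax₂ (_ , _ , _) (_ , _ , _) = refl
  set-⊕ ax₃ (_ , _ , _) (_ , _ , _) = refl

  set-· : ∀ i {x} k v → k · set i x v ≡ set i (k * x) (k · v)
  set-· ax₁ k (_ , _ , _) = refl
  set-· ax₂ k (_ , _ , _) = refl
  set-· ax₃ k (_ , _ , _) = refl

  shadow-linearlyClosed : ∀ {C} → IsLinear p C → ∀ i → IsLinearlyClosed (Shadow C i)
  shadow-linearlyClosed {C} (_ , C-⊕ , C-·) i = record
    { ⊕-closed = λ { {u} {v} (x , ux∈C) (y , vy∈C) →
        x + y , subst (λ w → C w ≡ true) (set-⊕ i u v) (C-⊕ _ _ ux∈C vy∈C) }
    ; ·-closed = λ { k {v} (x , vx∈C) →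
        k * x , subst (λ w → C w ≡ true) (set-· i k v) (C-· k _ vx∈C) }
    }

  onAxisLine⇒shadow : ∀ {C v w} → OnAxisLine v w → C w ≡ true → ∃ λ i → Shadow C i v
  onAxisLine⇒shadow (along₁ x) w∈C = ax₁ , x , w∈C
  onAxisLine⇒shadow (along₂ y) w∈C = ax₂ , y , w∈C
  onAxisLine⇒shadow (along₃ z) w∈C = ax₃ , z , w∈C

  ∀-or-∃¬ : ∀ {S : Pred V 0ℓ} → Decidable S → (∀ v → S v) ⊎ ∃ λ v → ¬ S v
  ∀-or-∃¬ {S} S? with all? (λ a → all? λ b → all? λ c → S? (a , b , c))
  ... | yes ∀S = inj₁ λ (a , b , c) → ∀S a b c
  ... | no ¬∀S with ¬∀⟶∃¬ p _ (λ a → all? λ b → all? λ c → S? (a , b , c)) ¬∀S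
  ... | a , ¬∀S₂ with ¬∀⟶∃¬ p _ (λ b → all? λ c → S? (a , b , c)) ¬∀S₂
  ... | b , ¬∀S₃ with ¬∀⟶∃¬ p _ (λ c → S? (a , b , c)) ¬∀S₃
  ... | c , ∉S = inj₂ ((a , b , c) , ∉S)

  covered⇒full-shadow : p % 2 ≡ 1 → ∀ {C} → IsLinear p C → (∀ v → ∃ λ i → Shadow C i v) →
                        ∃ λ i → ∀ v → Shadow C i v
  covered⇒full-shadow odd {C} linear covered
    with ∀-or-∃¬ (shadow? C ax₁) | ∀-or-∃¬ (shadow? C ax₂) | ∀-or-∃¬ (shadow? C ax₃)
  ... | inj₁ full | _         | _         = ax₁ , full
  ... | inj₂ _    | inj₁ full | _         = ax₂ , full
  ... | inj₂ _    | inj₂ _    | inj₁ full = ax₃ , full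
  ... | inj₂ (x₁ , ∉₁) | inj₂ (x₂ , ∉₂) | inj₂ (x₃ , ∉₃)
    with avoid₃ odd {x₁ = x₁} {x₂} {x₃}
           (shadow-linearlyClosed {C} linear ax₁) (shadow-linearlyClosed {C} linear ax₂)
           (shadow-linearlyClosed {C} linear ax₃)
           (shadow? C ax₁) (shadow? C ax₂) (shadow? C ax₃) ∉₁ ∉₂ ∉₃
  ... | v , v∉₁ , v∉₂ , v∉₃ with covered v
  ...   | ax₁ , v∈ = contradiction v∈ v∉₁
  ...   | ax₂ , v∈ = contradiction v∈ v∉₂
  ...   | ax₃ , v∈ = contradiction v∈ v∉₃

  card≡∑∑∑₁ : ∀ C → card p C ≡ ∑[ b < p ] ∑[ c < p ] ∑[ a < p ] boolToℕ (C (a , b , c))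
  card≡∑∑∑₁ C = begin
    card p C                                 ≡⟨ card≡∑∑∑ C ⟩
    ∑[ a < p ] ∑[ b < p ] ∑[ c < p ] χ a b c ≡⟨ ∑-comm (λ a b → ∑[ c < p ] χ a b c) ⟩
    ∑[ b < p ] ∑[ a < p ] ∑[ c < p ] χ a b c ≡⟨ sum-cong-≗ (λ b → ∑-comm (λ a c → χ a b c)) ⟩
    ∑[ b < p ] ∑[ c < p ] ∑[ a < p ] χ a b c ∎
    where
    χ : F → F → F → ℕ
    χ a b c = boolToℕ (C (a , b , c))

  card≡∑∑∑₂ : ∀ C → card p C ≡ ∑[ a < p ] ∑[ c < p ] ∑[ b < p ] boolToℕ (C (a , b , c))
  card≡∑∑∑₂ C = trans (card≡∑∑∑ C) (sum-cong-≗ λ a → ∑-comm (λ b c → boolToℕ (C (a , b , c))))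

  full-shadow⇒p²≤card : ∀ C i → (∀ v → Shadow C i v) → p ^ 2 ≤ card p C
  full-shadow⇒p²≤card C ax₁ full = subst (p ^ 2 ≤_) (sym (card≡∑∑∑₁ C))
    (n²≤∑∑∑ p (λ b c a → C (a , b , c)) (λ b c → full (b , b , c)))
  full-shadow⇒p²≤card C ax₂ full = subst (p ^ 2 ≤_) (sym (card≡∑∑∑₂ C))
    (n²≤∑∑∑ p (λ a c b → C (a , b , c)) (λ a c → full (a , a , c)))
  full-shadow⇒p²≤card C ax₃ full = subst (p ^ 2 ≤_) (sym (card≡∑∑∑ C))
    (n²≤∑∑∑ p (λ a b c → C (a , b , c)) (λ a b → full (a , b , a)))

  dominating⇒covered : ∀ {C} → (∀ v → ∃ λ w → w ∈J[ C , v ]ₚ) → ∀ v → ∃ λ i → Shadow C i v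
  dominating⇒covered {C} dominating v =
    let w , v~w , w∈C = dominating v in onAxisLine⇒shadow {C} (closedNbhd⇒onAxisLine v~w) w∈C

  linear-dominating⇒p²≤card : p % 2 ≡ 1 → ∀ C → IsLinear p C →
                              (∀ v → ∃ λ w → w ∈J[ C , v ]ₚ) → p ^ 2 ≤ card p C
  linear-dominating⇒p²≤card odd C linear dominating =
    let i , full = covered⇒full-shadow odd {C} linear (dominating⇒covered dominating)
    in full-shadow⇒p²≤card C i full

  γLID≡p² : p % 2 ≡ 1 → γLID≡ p (p ^ 2)
  γLID≡p² odd = (zeroSumCode , (zeroSumCode-linear , zeroSumCode-identifying) , card-zeroSumCode)
              , λ C (linear , (dominating , _)) → linear-dominating⇒p²≤card odd C linear dominating

mainTheorem11 : (p : ℕ) .{{_ : NonZero p}} → Prime p → p % 2 ≡ 1 → γLID≡ p (p ^ 2)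
mainTheorem11 p _ odd = Hamming.γLID≡p² p odd
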